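{- Let $p$ be a prime and $h\in\mathbb{Z}^+$. (i) For any $c,c_1,\ldots,c_{p^h-1}\in\mathbb{Z}$, $$\sum_{\substack{I\subseteq[1,p^h-1]\\ p^h\mid\sum_{s\in I}c_s-c}}(-1)^{|I|}\equiv c_1\cdots c_{p^h-1}\pmod p.$$ (ii) For any $c,c_1,\ldots,c_{2p^h-2}\in\mathbb{Z}$, $$\Big|\Big\{I\subseteq[1,2p^h-2]:\ |I|=p^h-1\ \text{and}\ p^h\ \Big|\ \sum_{s\in I}c_s-c\Big\}\Big|\equiv[x^{p^h-1}]\prod_{s=1}^{2p^h-2}(x-c_s)\pmod p.$$
   Context: $[1,n]=\{1,\ldots,n\}$; $[x^{j}]Q(x)$ denotes the coefficient of $x^j$ in the polynomial $Q(x)$. -}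

module Defs where

open import Data.Nat as ℕ using (ℕ; zero; suc)
open import Data.Nat.Divisibility using (_∣?_)
open import Data.Integer as ℤ using (ℤ; +_; _+_; _-_; _*_; -_; ∣_∣)
open import Data.Fin using (Fin; zero; suc)
open import Data.Fin.Subset using (Subset; inside; outside)
open import Data.Vec using (Vec; []; _∷_)
open import Data.List using (List; []; _∷_; map; _++_; foldr; filter)
open import Data.Bool using (Bool; true; false; if_then_else_; _∧_)
open import Relation.Nullary.Decidable using (⌊_⌋)

-- All 2^n subsets of [1,n] (represented as Fin n, index s ↦ s+1).
allSubsets : (n : ℕ) → List (Subset n)
allSubsets zero = [] ∷ []
allSubsets (suc n) = map (outside ∷_) (allSubsets n) ++ map (inside ∷_) (allSubsets n)

subsetSum : {n : ℕ} → (Fin n → ℤ) → Subset n → ℤ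
subsetSum {zero} c [] = + 0
subsetSum {suc n} c (outside ∷ I) = subsetSum (λ i → c (suc i)) I
subsetSum {suc n} c (inside ∷ I) = c zero + subsetSum (λ i → c (suc i)) I

card : {n : ℕ} → Subset n → ℕ
card [] = 0
card (outside ∷ I) = card I
card (inside ∷ I) = suc (card I)

-- Boolean test: m ∣ z in ℤ (stdlib: m ∣ z iff m ∣ |z| in ℕ)
divides? : ℕ → ℤ → Bool
divides? m z = ⌊ m ∣? ∣ z ∣ ⌋

sign : ℕ → ℤ
sign zero = + 1
sign (suc k) = - sign k

sumℤ : List ℤ → ℤ
sumℤ = foldr _+_ (+ 0)

signedSum : (m n : ℕ) → ℤ → (Fin n → ℤ) → ℤ
signedSum m n c cs =
  sumℤ (map (λ I → if divides? m (subsetSum cs I - c) then sign (card I) else + 0) (allSubsets n))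

countSubsets : (m n k : ℕ) → ℤ → (Fin n → ℤ) → ℕ
countSubsets m n k c cs =
  foldr ℕ._+_ 0 (map (λ I → if ⌊ card I ℕ.≟ k ⌋ ∧ divides? m (subsetSum cs I - c) then 1 else 0) (allSubsets n))

prodℤ : (n : ℕ) → (Fin n → ℤ) → ℤ
prodℤ zero c = + 1
prodℤ (suc n) c = c zero * prodℤ n (λ i → c (suc i))

-- Polynomials over ℤ as coefficient lists, lowest degree first.
Poly : Set
Poly = List ℤ

-- (x - a) · Q : coefficients r_0 = -a q_0, r_j = q_{j-1} - a q_j, r_{d+1} = q_d
mulLinearGo : ℤ → ℤ → Poly → Poly
mulLinearGo a prev [] = prev ∷ []
mulLinearGo a prev (q ∷ qs) = (prev - a * q) ∷ mulLinearGo a q qs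

mulLinear : ℤ → Poly → Poly
mulLinear a [] = []
mulLinear a (q ∷ qs) = (- (a * q)) ∷ mulLinearGo a q qs

linProd : (n : ℕ) → (Fin n → ℤ) → Poly
linProd zero c = + 1 ∷ []
linProd (suc n) c = mulLinear (c zero) (linProd n (λ i → c (suc i)))

coeff : ℕ → Poly → ℤ
coeff j [] = + 0
coeff zero (q ∷ qs) = q
coeff (suc j) (q ∷ qs) = coeff j qs

-- Let χ be the indicator function of p^h ℤ, n = p^h - 1, Δ_c g (y) = g y - g (y + c) and
-- S_c g (y) = g (y + c). Expanding over subsets, the signed sum in (i) is (Δ_{c_1} ⋯ Δ_{c_n} χ)(-c)
-- and the count in (ii) is (e_n(S_{c_1}, …, S_{c_N}) χ)(-c), N = 2n, e_n the elementary
-- symmetric polynomial.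
--
-- Modulo p, Δ_1^{p^h} g (y) ≡ g y + (-1)^{p^h} g (y + p^h), because p divides C(p^h, j) for
-- 0 < j < p^h; as χ is p^h-periodic, Δ_1^{n+1} χ ≡ 0. Whenever Δ_1^{k+1} g ≡ 0, the function
-- Δ_1^k g is constant mod p, so Δ_c Δ_1^{k-1} g ≡ c Δ_1^k g, and induction gives
-- e_k(Δ_{c_1}, …, Δ_{c_N}) g ≡ e_k(c) Δ_1^k g. For g = χ and k = n, Δ_1^n χ ≡ (Δ_1^n χ)(0) = χ(0) = 1
-- as χ vanishes on 1, …, n; with N = n this is (i). For (ii), Δ_c = 1 - S_c gives
-- e_n(Δ) = Σ_{j ≤ n} (-1)^j C(N - j, n - j) e_j(S), and p divides C(N - j, n - j) = C(p^h + i, i + 1)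
-- for j < n, so e_n(S) χ ≡ (-1)^n e_n(c), the coefficient of x^n in ∏ (x - c_s).

module Submission where

open import Defs
open import Data.Bool using (true; false; if_then_else_; _∧_)
open import Data.Fin using (Fin)
open import Data.Fin.Subset using (Subset; inside; outside)
open import Data.Integer using (ℤ; +_; -[1+_]; _+_; _*_; _-_; -_; ∣_∣)
open import Data.Integer.Properties
  using (+-assoc; *-assoc; +-identityˡ; +-identityʳ; *-identityˡ; *-identityʳ; *-zeroˡ; *-zeroʳ; +-inverseʳ;
         *-distribˡ-+; *-distribʳ-+; neg-distrib-+; neg-distribˡ-*; pos-+)
import Data.Integer.Divisibility as ℤ
open import Data.Integer.Divisibility.Signed
  using (_∣_; divides; ∣m⇒∣-m; ∣m∣n⇒∣m+n; ∣m+n∣n⇒∣m; ∣m⇒∣m*n; ∣n⇒∣m*n; ∣ᵤ⇒∣; ∣⇒∣ᵤ)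
open import Data.Integer.Tactic.RingSolver using (solve-∀)
open import Data.List using (List; []; _∷_; map; _++_)
open import Data.List.Properties using (map-++; map-cong; map-∘)
open import Data.Nat as ℕ using (ℕ; zero; suc; _∸_; _^_; z≤n; s≤s)
import Data.Nat.Properties as ℕ
import Data.Nat.Divisibility as ℕ
open import Data.Nat.Combinatorics using (_C_; nCk+nC[k+1]≡[n+1]C[k+1]; nCn≡1; nC1≡n)
open import Data.Nat.ListAction using (sum)
open import Data.Nat.ListAction.Properties using (sum-++)
open import Data.Nat.Primality using (Prime; euclidsLemma; prime⇒nonZero)
open import Data.Nat.Tactic.RingSolver renaming (solve-∀ to ℕ-solve-∀)
open import Data.Product using (_×_; _,_)
open import Data.Sum using (inj₁; inj₂)
open import Data.Vec using (_∷_)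
open import Data.Vec.Functional using (Vector; head; tail)
open import Function using (_∘_)
open import Function.Bundles using (mk⇔)
open import Level using (0ℓ)
open import Relation.Binary.Bundles using (Setoid)
open import Relation.Binary.PropositionalEquality
import Relation.Binary.Reasoning.Setoid
open import Relation.Nullary using (yes; no; ¬_; contradiction)
open import Relation.Nullary.Decidable using (⌊_⌋; ⌊⌋-map′; isYes≗does; does-⇔; dec-true; dec-false)

sumUpTo : ℕ → (ℕ → ℤ) → ℤ
sumUpTo zero a = a 0
sumUpTo (suc k) a = sumUpTo k a + a (suc k)

sumUpTo-cong : ∀ k {a b : ℕ → ℤ} → (∀ j → j ℕ.≤ k → a j ≡ b j) → sumUpTo k a ≡ sumUpTo k b
sumUpTo-cong zero eq = eq 0 z≤n
sumUpTo-cong (suc k) eq =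
  cong₂ _+_ (sumUpTo-cong k (λ j j≤k → eq j (ℕ.m≤n⇒m≤1+n j≤k))) (eq (suc k) ℕ.≤-refl)

sumUpTo-+ : ∀ k (a b : ℕ → ℤ) → sumUpTo k (λ j → a j + b j) ≡ sumUpTo k a + sumUpTo k b
sumUpTo-+ zero a b = refl
sumUpTo-+ (suc k) a b = begin
  sumUpTo k (λ j → a j + b j) + (a (suc k) + b (suc k))
    ≡⟨ cong (_+ (a (suc k) + b (suc k))) (sumUpTo-+ k a b) ⟩
  sumUpTo k a + sumUpTo k b + (a (suc k) + b (suc k))
    ≡⟨ interchange (sumUpTo k a) (sumUpTo k b) (a (suc k)) (b (suc k)) ⟩
  sumUpTo k a + a (suc k) + (sumUpTo k b + b (suc k)) ∎
  where
  open ≡-Reasoning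
  interchange : ∀ x y z w → x + y + (z + w) ≡ x + z + (y + w)
  interchange = solve-∀

sumUpTo-neg : ∀ k (a : ℕ → ℤ) → sumUpTo k (λ j → - a j) ≡ - sumUpTo k a
sumUpTo-neg zero a = refl
sumUpTo-neg (suc k) a = begin
  sumUpTo k (λ j → - a j) + - a (suc k) ≡⟨ cong (_+ - a (suc k)) (sumUpTo-neg k a) ⟩
  - sumUpTo k a + - a (suc k)           ≡⟨ neg-distrib-+ (sumUpTo k a) (a (suc k)) ⟨
  - (sumUpTo k a + a (suc k))           ∎
  where open ≡-Reasoning

sumUpTo-suc : ∀ k (a : ℕ → ℤ) → sumUpTo (suc k) a ≡ a 0 + sumUpTo k (λ j → a (suc j))
sumUpTo-suc zero a = refl
sumUpTo-suc (suc k) a = begin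
  sumUpTo (suc k) a + a (2 ℕ.+ k)                 ≡⟨ cong (_+ a (2 ℕ.+ k)) (sumUpTo-suc k a) ⟩
  a 0 + sumUpTo k (λ j → a (suc j)) + a (2 ℕ.+ k) ≡⟨ +-assoc (a 0) (sumUpTo k (λ j → a (suc j))) (a (2 ℕ.+ k)) ⟩
  a 0 + (sumUpTo k (λ j → a (suc j)) + a (2 ℕ.+ k)) ∎
  where open ≡-Reasoning

sumUpTo-zero : ∀ k {a : ℕ → ℤ} → (∀ j → j ℕ.≤ k → a j ≡ + 0) → sumUpTo k a ≡ + 0
sumUpTo-zero k {a} eq = trans (sumUpTo-cong k eq) (zeros k)
  where
  zeros : ∀ k → sumUpTo k (λ _ → + 0) ≡ + 0
  zeros zero = refl
  zeros (suc k) = cong (_+ + 0) (zeros k)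

-- With this sign ΔΠ n cs g y is the alternating sum Σ_I (-1)^|I| g (y + Σ_{s ∈ I} c_s).
Δ[_] : ℤ → (ℤ → ℤ) → ℤ → ℤ
Δ[ a ] g y = g y - g (y + a)

Δ[_]-cong : ∀ a {f g : ℤ → ℤ} → f ≗ g → Δ[ a ] f ≗ Δ[ a ] g
Δ[ a ]-cong f≗g y = cong₂ _-_ (f≗g y) (f≗g (y + a))

Δ-comm : ∀ a c (g : ℤ → ℤ) → Δ[ c ] (Δ[ a ] g) ≗ Δ[ a ] (Δ[ c ] g)
Δ-comm a c g z = begin
  (g z - g (z + a)) - (g (z + c) - g (z + c + a))
    ≡⟨ cong (λ t → (g z - g (z + a)) - (g (z + c) - g t)) (swap z c a) ⟩
  (g z - g (z + a)) - (g (z + c) - g (z + a + c))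
    ≡⟨ exchange (g z) (g (z + a)) (g (z + c)) (g (z + a + c)) ⟩
  (g z - g (z + c)) - (g (z + a) - g (z + a + c)) ∎
  where
  open ≡-Reasoning
  swap : ∀ z c a → z + c + a ≡ z + a + c
  swap = solve-∀
  exchange : ∀ w x y z → (w - x) - (y - z) ≡ (w - y) - (x - z)
  exchange = solve-∀

ΔΠ : (n : ℕ) → Vector ℤ n → (ℤ → ℤ) → ℤ → ℤ
ΔΠ zero cs g = g
ΔΠ (suc n) cs g = ΔΠ n (tail cs) (Δ[ head cs ] g)

Δ^ : ℕ → (ℤ → ℤ) → ℤ → ℤ
Δ^ k = ΔΠ k (λ _ → + 1)

ΔΠ-cong : ∀ n cs {f g : ℤ → ℤ} → f ≗ g → ΔΠ n cs f ≗ ΔΠ n cs g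
ΔΠ-cong zero cs f≗g = f≗g
ΔΠ-cong (suc n) cs f≗g = ΔΠ-cong n (tail cs) (Δ[ head cs ]-cong f≗g)

ΔΠ-Δ : ∀ n cs a (g : ℤ → ℤ) → ΔΠ n cs (Δ[ a ] g) ≗ Δ[ a ] (ΔΠ n cs g)
ΔΠ-Δ zero cs a g y = refl
ΔΠ-Δ (suc n) cs a g y = begin
  ΔΠ n (tail cs) (Δ[ head cs ] (Δ[ a ] g)) y ≡⟨ ΔΠ-cong n (tail cs) (Δ-comm a (head cs) g) y ⟩
  ΔΠ n (tail cs) (Δ[ a ] (Δ[ head cs ] g)) y ≡⟨ ΔΠ-Δ n (tail cs) a (Δ[ head cs ] g) y ⟩
  Δ[ a ] (ΔΠ n (tail cs) (Δ[ head cs ] g)) y ∎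
  where open ≡-Reasoning

Δ^-suc : ∀ k (g : ℤ → ℤ) → Δ^ (suc k) g ≗ Δ[ + 1 ] (Δ^ k g)
Δ^-suc k g = ΔΠ-Δ k (λ _ → + 1) (+ 1) g

Δ^-zero : ∀ k y → Δ^ k (λ _ → + 0) y ≡ + 0
Δ^-zero zero y = refl
Δ^-zero (suc k) y = Δ^-zero k y

Δ^-vanishing : ∀ k (g : ℤ → ℤ) y → (∀ j → 1 ℕ.≤ j → j ℕ.≤ k → g (y + + j) ≡ + 0) → Δ^ k g y ≡ g y
Δ^-vanishing zero g y _ = refl
Δ^-vanishing (suc k) g y g≡0 = begin
  Δ^ k (Δ[ + 1 ] g) y ≡⟨ Δ^-vanishing k (Δ[ + 1 ] g) y Δg≡0 ⟩
  g y - g (y + + 1)   ≡⟨ cong (λ t → g y - t) (g≡0 1 ℕ.≤-refl (s≤s z≤n)) ⟩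
  g y - + 0           ≡⟨ +-identityʳ (g y) ⟩
  g y                 ∎
  where
  open ≡-Reasoning
  shift : ∀ y j → y + j + + 1 ≡ y + (+ 1 + j)
  shift = solve-∀
  Δg≡0 : ∀ j → 1 ℕ.≤ j → j ℕ.≤ k → Δ[ + 1 ] g (y + + j) ≡ + 0
  Δg≡0 j 1≤j j≤k = cong₂ _-_ (g≡0 j 1≤j (ℕ.m≤n⇒m≤1+n j≤k))
                              (trans (cong g (shift y (+ j))) (g≡0 (suc j) (s≤s z≤n) (s≤s j≤k)))

esym : (N k : ℕ) → Vector ℤ N → ℤ
esym N zero cs = + 1
esym zero (suc k) cs = + 0
esym (suc N) (suc k) cs = esym N (suc k) (tail cs) + head cs * esym N k (tail cs)

-- esymΔ and esymShift are esym evaluated at the commuting operators Δ[ c ] and g ↦ g (· + c).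
esymΔ : (N k : ℕ) → Vector ℤ N → (ℤ → ℤ) → ℤ → ℤ
esymΔ N zero cs g = g
esymΔ zero (suc k) cs g y = + 0
esymΔ (suc N) (suc k) cs g y = esymΔ N (suc k) (tail cs) g y + esymΔ N k (tail cs) (Δ[ head cs ] g) y

esymShift : (N k : ℕ) → Vector ℤ N → (ℤ → ℤ) → ℤ → ℤ
esymShift N zero cs g = g
esymShift zero (suc k) cs g y = + 0
esymShift (suc N) (suc k) cs g y = esymShift N (suc k) (tail cs) g y + esymShift N k (tail cs) g (y + head cs)

esym-vanish : ∀ N k cs → N ℕ.< k → esym N k cs ≡ + 0
esym-vanish zero (suc k) cs _ = refl
esym-vanish (suc N) (suc k) cs (s≤s N<k) = begin
  esym N (suc k) (tail cs) + head cs * esym N k (tail cs)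
    ≡⟨ cong₂ (λ u v → u + head cs * v) (esym-vanish N (suc k) (tail cs) (ℕ.m<n⇒m<1+n N<k))
                                        (esym-vanish N k (tail cs) N<k) ⟩
  + 0 + head cs * + 0 ≡⟨ cong (λ t → + 0 + t) (*-zeroʳ (head cs)) ⟩
  + 0                 ∎
  where open ≡-Reasoning

esymΔ-vanish : ∀ N k cs g y → N ℕ.< k → esymΔ N k cs g y ≡ + 0
esymΔ-vanish zero (suc k) cs g y _ = refl
esymΔ-vanish (suc N) (suc k) cs g y (s≤s N<k) =
  cong₂ _+_ (esymΔ-vanish N (suc k) (tail cs) g y (ℕ.m<n⇒m<1+n N<k))
            (esymΔ-vanish N k (tail cs) _ y N<k)

esymShift-vanish : ∀ N k cs g y → N ℕ.< k → esymShift N k cs g y ≡ + 0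
esymShift-vanish zero (suc k) cs g y _ = refl
esymShift-vanish (suc N) (suc k) cs g y (s≤s N<k) =
  cong₂ _+_ (esymShift-vanish N (suc k) (tail cs) g y (ℕ.m<n⇒m<1+n N<k))
            (esymShift-vanish N k (tail cs) g _ N<k)

esym-top : ∀ N cs → esym N N cs ≡ prodℤ N cs
esym-top zero cs = refl
esym-top (suc N) cs = begin
  esym N (suc N) (tail cs) + head cs * esym N N (tail cs)
    ≡⟨ cong₂ (λ u v → u + head cs * v) (esym-vanish N (suc N) (tail cs) ℕ.≤-refl) (esym-top N (tail cs)) ⟩
  + 0 + head cs * prodℤ N (tail cs) ≡⟨ +-identityˡ _ ⟩
  head cs * prodℤ N (tail cs)       ∎
  where open ≡-Reasoning

ΔΠ≡esymΔ : ∀ N cs g y → ΔΠ N cs g y ≡ esymΔ N N cs g y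
ΔΠ≡esymΔ zero cs g y = refl
ΔΠ≡esymΔ (suc N) cs g y = begin
  ΔΠ N (tail cs) (Δ[ head cs ] g) y     ≡⟨ ΔΠ≡esymΔ N (tail cs) _ y ⟩
  esymΔ N N (tail cs) (Δ[ head cs ] g) y ≡⟨ +-identityˡ _ ⟨
  + 0 + esymΔ N N (tail cs) (Δ[ head cs ] g) y
    ≡⟨ cong (_+ esymΔ N N (tail cs) (Δ[ head cs ] g) y) (esymΔ-vanish N (suc N) (tail cs) g y ℕ.≤-refl) ⟨
  esymΔ N (suc N) (tail cs) g y + esymΔ N N (tail cs) (Δ[ head cs ] g) y ∎
  where open ≡-Reasoning

esymShift-Δ : ∀ N k cs a (g : ℤ → ℤ) → esymShift N k cs (Δ[ a ] g) ≗ Δ[ a ] (esymShift N k cs g)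
esymShift-Δ N zero cs a g y = refl
esymShift-Δ zero (suc k) cs a g y = refl
esymShift-Δ (suc N) (suc k) cs a g y = begin
  F (Δ[ a ] g) y + G (Δ[ a ] g) (y + c)
    ≡⟨ cong₂ _+_ (esymShift-Δ N (suc k) cs' a g y) (esymShift-Δ N k cs' a g (y + c)) ⟩
  (F g y - F g (y + a)) + (G g (y + c) - G g (y + c + a))
    ≡⟨ cong (λ t → (F g y - F g (y + a)) + (G g (y + c) - G g t)) (swap y c a) ⟩
  (F g y - F g (y + a)) + (G g (y + c) - G g (y + a + c))
    ≡⟨ regroup (F g y) (F g (y + a)) (G g (y + c)) (G g (y + a + c)) ⟩
  (F g y + G g (y + c)) - (F g (y + a) + G g (y + a + c)) ∎
  where
  open ≡-Reasoning
  cs' = tail cs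
  c = head cs
  F G : (ℤ → ℤ) → ℤ → ℤ
  F = esymShift N (suc k) cs'
  G = esymShift N k cs'
  swap : ∀ z c a → z + c + a ≡ z + a + c
  swap = solve-∀
  regroup : ∀ w x y z → (w - x) + (y - z) ≡ (w + y) - (x + z)
  regroup = solve-∀

esymShift-const : ∀ N j (g : ℤ → ℤ) y → esymShift N j (λ _ → + 1) g y ≡ + (N C j) * g (y + + j)
esymShift-const N zero g y = sym (trans (*-identityˡ _) (cong g (+-identityʳ y)))
esymShift-const zero (suc j) g y = refl
esymShift-const (suc N) (suc j) g y = begin
  esymShift N (suc j) ones g y + esymShift N j ones g (y + + 1)
    ≡⟨ cong₂ _+_ (esymShift-const N (suc j) g y) (esymShift-const N j g (y + + 1)) ⟩
  + (N C suc j) * g (y + + suc j) + + (N C j) * g (y + + 1 + + j)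
    ≡⟨ cong (λ t → + (N C suc j) * g (y + + suc j) + + (N C j) * g t) (shift y (+ j)) ⟩
  + (N C suc j) * g (y + + suc j) + + (N C j) * g (y + + suc j)
    ≡⟨ *-distribʳ-+ (g (y + + suc j)) (+ (N C suc j)) (+ (N C j)) ⟨
  (+ (N C suc j) + + (N C j)) * g (y + + suc j)
    ≡⟨ cong (λ n → + n * g (y + + suc j)) (trans (ℕ.+-comm (N C suc j) (N C j)) (nCk+nC[k+1]≡[n+1]C[k+1] N j)) ⟩
  + (suc N C suc j) * g (y + + suc j) ∎
  where
  open ≡-Reasoning
  ones : Vector ℤ N
  ones _ = + 1
  shift : ∀ y j → y + + 1 + j ≡ y + (+ 1 + j)
  shift = solve-∀

pascal-∸ : ∀ {N k j} → j ℕ.≤ k → j ℕ.≤ N →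
           (N ∸ j) C (suc k ∸ j) ℕ.+ (N ∸ j) C (k ∸ j) ≡ (suc N ∸ j) C (suc k ∸ j)
pascal-∸ {N} {k} {j} j≤k j≤N
  rewrite ℕ.+-∸-assoc 1 j≤k | ℕ.+-∸-assoc 1 j≤N =
  trans (ℕ.+-comm ((N ∸ j) C suc (k ∸ j)) _) (nCk+nC[k+1]≡[n+1]C[k+1] (N ∸ j) (k ∸ j))

esymΔ-expansion : ∀ N k cs g y →
  esymΔ N k cs g y ≡ sumUpTo k (λ j → sign j * + ((N ∸ j) C (k ∸ j)) * esymShift N j cs g y)
esymΔ-expansion N zero cs g y = sym (*-identityˡ (g y))
esymΔ-expansion zero (suc k) cs g y = sym (sumUpTo-zero (suc k) empty)
  where
  empty : ∀ j → j ℕ.≤ suc k → sign j * + ((0 ∸ j) C (suc k ∸ j)) * esymShift zero j cs g y ≡ + 0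
  empty zero _ = refl
  empty (suc j) _ = *-zeroʳ (sign (suc j) * + (0 C (k ∸ j)))
-- As Δ[ c ] = 1 - S_c, the terms F j free of S_c combine by Pascal's rule, the others are the G j.
esymΔ-expansion (suc N) (suc k) cs g y = begin
  esymΔ N K cs' g y + esymΔ N k cs' (Δ[ c ] g) y
    ≡⟨ cong₂ _+_ (esymΔ-expansion N K cs' g y) (esymΔ-expansion N k cs' (Δ[ c ] g) y) ⟩
  sumUpTo K (λ j → a j * F j) + sumUpTo k (λ j → b j * esymShift N j cs' (Δ[ c ] g) y)
    ≡⟨ cong (_+_ (sumUpTo K (λ j → a j * F j))) (sumUpTo-cong k (λ j _ → cong (b j *_) (esymShift-Δ N j cs' c g y))) ⟩
  sumUpTo K (λ j → a j * F j) + sumUpTo k (λ j → b j * (F j - G j))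
    ≡⟨ cong (_+_ (sumUpTo K (λ j → a j * F j))) split-difference ⟩
  sumUpTo K (λ j → a j * F j) + (sumUpTo k (λ j → b j * F j) - sumUpTo k (λ j → b j * G j))
    ≡⟨ +-assoc (sumUpTo K (λ j → a j * F j)) _ _ ⟨
  sumUpTo K (λ j → a j * F j) + sumUpTo k (λ j → b j * F j) - sumUpTo k (λ j → b j * G j)
    ≡⟨ cong₂ _+_ pascal-step shift-step ⟩
  sumUpTo K (λ j → a′ j * F j) + sumUpTo K (λ j → a′ j * G⁻ j)
    ≡⟨ sumUpTo-+ K (λ j → a′ j * F j) (λ j → a′ j * G⁻ j) ⟨
  sumUpTo K (λ j → a′ j * F j + a′ j * G⁻ j)
    ≡⟨ sumUpTo-cong K (λ j _ → trans (sym (*-distribˡ-+ (a′ j) (F j) (G⁻ j))) (cong (a′ j *_) (F+G⁻ j))) ⟩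
  sumUpTo K (λ j → a′ j * esymShift (suc N) j cs g y) ∎
  where
  open ≡-Reasoning
  K = suc k
  cs' = tail cs
  c = head cs
  F G G⁻ a b a′ : ℕ → ℤ
  F j = esymShift N j cs' g y
  G j = esymShift N j cs' g (y + c)
  G⁻ zero = + 0
  G⁻ (suc j) = G j
  a j = sign j * + ((N ∸ j) C (K ∸ j))
  b j = sign j * + ((N ∸ j) C (k ∸ j))
  a′ j = sign j * + ((suc N ∸ j) C (K ∸ j))

  F+G⁻ : ∀ j → F j + G⁻ j ≡ esymShift (suc N) j cs g y
  F+G⁻ zero = +-identityʳ (g y)
  F+G⁻ (suc j) = refl

  split-difference : sumUpTo k (λ j → b j * (F j - G j)) ≡ sumUpTo k (λ j → b j * F j) - sumUpTo k (λ j → b j * G j)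
  split-difference = begin
    sumUpTo k (λ j → b j * (F j - G j))
      ≡⟨ sumUpTo-cong k (λ j _ → distrib-minus (b j) (F j) (G j)) ⟩
    sumUpTo k (λ j → b j * F j + - (b j * G j))
      ≡⟨ sumUpTo-+ k _ _ ⟩
    sumUpTo k (λ j → b j * F j) + sumUpTo k (λ j → - (b j * G j))
      ≡⟨ cong (_+_ (sumUpTo k (λ j → b j * F j))) (sumUpTo-neg k (λ j → b j * G j)) ⟩
    sumUpTo k (λ j → b j * F j) - sumUpTo k (λ j → b j * G j) ∎
    where
    distrib-minus : ∀ s u v → s * (u - v) ≡ s * u + - (s * v)
    distrib-minus = solve-∀

  term-pascal : ∀ j → j ℕ.≤ k → a j * F j + b j * F j ≡ a′ j * F j
  term-pascal j j≤k with j ℕ.≤? N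
  ... | yes j≤N = begin
    a j * F j + b j * F j ≡⟨ *-distribʳ-+ (F j) (a j) (b j) ⟨
    (a j + b j) * F j     ≡⟨ cong (_* F j) (*-distribˡ-+ (sign j) _ _) ⟨
    sign j * (+ ((N ∸ j) C (K ∸ j)) + + ((N ∸ j) C (k ∸ j))) * F j
      ≡⟨ cong (λ n → sign j * n * F j) (trans (sym (pos-+ ((N ∸ j) C (K ∸ j)) ((N ∸ j) C (k ∸ j)))) (cong +_ (pascal-∸ j≤k j≤N))) ⟩
    a′ j * F j ∎
  ... | no j≰N rewrite esymShift-vanish N j cs' g y (ℕ.≰⇒> j≰N) =
    trans (cong₂ _+_ (*-zeroʳ (a j)) (*-zeroʳ (b j))) (sym (*-zeroʳ (a′ j)))

  pascal-step : sumUpTo K (λ j → a j * F j) + sumUpTo k (λ j → b j * F j) ≡ sumUpTo K (λ j → a′ j * F j)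
  pascal-step = begin
    sumUpTo k (λ j → a j * F j) + a K * F K + sumUpTo k (λ j → b j * F j)
      ≡⟨ swap-last (sumUpTo k (λ j → a j * F j)) (a K * F K) _ ⟩
    sumUpTo k (λ j → a j * F j) + sumUpTo k (λ j → b j * F j) + a K * F K
      ≡⟨ cong₂ _+_ (sumUpTo-+ k _ _) top-coefficient ⟨
    sumUpTo k (λ j → a j * F j + b j * F j) + a′ K * F K
      ≡⟨ cong (_+ a′ K * F K) (sumUpTo-cong k term-pascal) ⟩
    sumUpTo K (λ j → a′ j * F j) ∎
    where
    swap-last : ∀ u v w → u + v + w ≡ u + w + v
    swap-last = solve-∀
    top-coefficient : a′ K * F K ≡ a K * F K
    top-coefficient rewrite ℕ.n∸n≡0 K = refl

  shift-step : - sumUpTo k (λ j → b j * G j) ≡ sumUpTo K (λ j → a′ j * G⁻ j)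
  shift-step = begin
    - sumUpTo k (λ j → b j * G j)
      ≡⟨ sumUpTo-neg k (λ j → b j * G j) ⟨
    sumUpTo k (λ j → - (b j * G j))
      ≡⟨ sumUpTo-cong k (λ j _ → neg-distribˡ-* (b j) (G j)) ⟩
    sumUpTo k (λ j → - b j * G j)
      ≡⟨ sumUpTo-cong k (λ j _ → cong (_* G j) (neg-distribˡ-* (sign j) _)) ⟩
    sumUpTo k (λ j → a′ (suc j) * G j)
      ≡⟨ +-identityˡ _ ⟨
    + 0 + sumUpTo k (λ j → a′ (suc j) * G j)
      ≡⟨ cong (_+ sumUpTo k (λ j → a′ (suc j) * G j)) (*-zeroʳ (a′ 0)) ⟨
    a′ 0 * + 0 + sumUpTo k (λ j → a′ (suc j) * G j)
      ≡⟨ sumUpTo-suc k (λ j → a′ j * G⁻ j) ⟨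
    sumUpTo K (λ j → a′ j * G⁻ j) ∎

module Congruence (d : ℤ) where

  -- A record, not a definition, so that a and b can be inferred from a ≈ b.
  infix 4 _≈_
  record _≈_ (a b : ℤ) : Set where
    constructor ∣⇒≈
    field ≈⇒∣ : d ∣ a - b
  open _≈_ public

  ≡⇒≈ : ∀ {a b} → a ≡ b → a ≈ b
  ≡⇒≈ {a} refl = ∣⇒≈ (subst (d ∣_) (sym (+-inverseʳ a)) (divides (+ 0) (sym (*-zeroˡ d))))

  ≈-refl : ∀ {a} → a ≈ a
  ≈-refl = ≡⇒≈ refl

  ≈-sym : ∀ {a b} → a ≈ b → b ≈ a
  ≈-sym {a} {b} (∣⇒≈ d∣a-b) = ∣⇒≈ (subst (d ∣_) (negate a b) (∣m⇒∣-m d∣a-b))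
    where
    negate : ∀ a b → - (a - b) ≡ b - a
    negate = solve-∀

  ≈-trans : ∀ {a b c} → a ≈ b → b ≈ c → a ≈ c
  ≈-trans {a} {b} {c} (∣⇒≈ d∣a-b) (∣⇒≈ d∣b-c) = ∣⇒≈ (subst (d ∣_) (telescope a b c) (∣m∣n⇒∣m+n d∣a-b d∣b-c))
    where
    telescope : ∀ a b c → (a - b) + (b - c) ≡ a - c
    telescope = solve-∀

  ≈-setoid : Setoid 0ℓ 0ℓ
  ≈-setoid = record
    { Carrier = ℤ
    ; _≈_ = _≈_
    ; isEquivalence = record { refl = ≈-refl ; sym = ≈-sym ; trans = ≈-trans }
    }

  module ≈-Reasoning = Relation.Binary.Reasoning.Setoid ≈-setoid

  +-cong : ∀ {a b c e} → a ≈ b → c ≈ e → a + c ≈ b + e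
  +-cong {a} {b} {c} {e} (∣⇒≈ a≈b) (∣⇒≈ c≈e) = ∣⇒≈ (subst (d ∣_) (regroup a b c e) (∣m∣n⇒∣m+n a≈b c≈e))
    where
    regroup : ∀ a b c e → (a - b) + (c - e) ≡ (a + c) - (b + e)
    regroup = solve-∀

  -‿cong : ∀ {a b} → a ≈ b → - a ≈ - b
  -‿cong {a} {b} (∣⇒≈ a≈b) = ∣⇒≈ (subst (d ∣_) (negate a b) (∣m⇒∣-m a≈b))
    where
    negate : ∀ a b → - (a - b) ≡ - a - - b
    negate = solve-∀

  *-cong : ∀ {a b c e} → a ≈ b → c ≈ e → a * c ≈ b * e
  *-cong {a} {b} {c} {e} (∣⇒≈ a≈b) (∣⇒≈ c≈e) =
    ∣⇒≈ (subst (d ∣_) (regroup a b c e) (∣m∣n⇒∣m+n (∣m⇒∣m*n c a≈b) (∣n⇒∣m*n b c≈e)))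
    where
    regroup : ∀ a b c e → (a - b) * c + b * (c - e) ≡ a * c - b * e
    regroup = solve-∀

  +-congˡ : ∀ x {a b} → a ≈ b → x + a ≈ x + b
  +-congˡ x = +-cong (≈-refl {x})

  +-congʳ : ∀ x {a b} → a ≈ b → a + x ≈ b + x
  +-congʳ x a≈b = +-cong a≈b (≈-refl {x})

  *-congˡ : ∀ x {a b} → a ≈ b → x * a ≈ x * b
  *-congˡ x = *-cong (≈-refl {x})

  ∣⇒≈0 : ∀ {x} → d ∣ x → x ≈ + 0
  ∣⇒≈0 {x} d∣x = ∣⇒≈ (subst (d ∣_) (sym (+-identityʳ x)) d∣x)

  -≈0⇒≈ : ∀ {a b} → a - b ≈ + 0 → a ≈ b
  -≈0⇒≈ {a} {b} (∣⇒≈ d∣a-b) = ∣⇒≈ (subst (d ∣_) (+-identityʳ (a - b)) d∣a-b)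

  ≈⇒-≈0 : ∀ {a b} → a ≈ b → a - b ≈ + 0
  ≈⇒-≈0 {a} {b} (∣⇒≈ d∣a-b) = ∣⇒≈ (subst (d ∣_) (sym (+-identityʳ (a - b))) d∣a-b)

  sumUpTo-≈0 : ∀ k (a : ℕ → ℤ) → (∀ j → j ℕ.≤ k → a j ≈ + 0) → sumUpTo k a ≈ + 0
  sumUpTo-≈0 zero a a≈0 = a≈0 0 z≤n
  sumUpTo-≈0 (suc k) a a≈0 =
    +-cong (sumUpTo-≈0 k a (λ j j≤k → a≈0 j (ℕ.m≤n⇒m≤1+n j≤k))) (a≈0 (suc k) ℕ.≤-refl)

  sumUpTo-≈last : ∀ k (a : ℕ → ℤ) → (∀ j → j ℕ.< k → a j ≈ + 0) → sumUpTo k a ≈ a k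
  sumUpTo-≈last zero a _ = ≈-refl
  sumUpTo-≈last (suc k) a a≈0 =
    ≈-trans (+-congʳ (a (suc k)) (sumUpTo-≈0 k a (λ j j≤k → a≈0 j (s≤s j≤k)))) (≡⇒≈ (+-identityˡ _))

  sumUpTo-≈ends : ∀ k (a : ℕ → ℤ) → (∀ j → 0 ℕ.< j → j ℕ.< suc k → a j ≈ + 0) →
                  sumUpTo (suc k) a ≈ a 0 + a (suc k)
  sumUpTo-≈ends zero a _ = ≈-refl
  sumUpTo-≈ends (suc k) a a≈0 = +-cong (begin
    sumUpTo (suc k) a                    ≡⟨ sumUpTo-suc k a ⟩
    a 0 + sumUpTo k (λ j → a (suc j))    ≈⟨ +-congˡ (a 0) (sumUpTo-≈0 k (λ j → a (suc j)) inner≈0) ⟩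
    a 0 + + 0                            ≡⟨ +-identityʳ (a 0) ⟩
    a 0                                  ∎) (≈-refl {a (2 ℕ.+ k)})
    where
    open ≈-Reasoning
    inner≈0 : ∀ j → j ℕ.≤ k → a (suc j) ≈ + 0
    inner≈0 j j≤k = a≈0 (suc j) (s≤s z≤n) (s≤s (s≤s j≤k))

  Δ-affine : ∀ (h s : ℤ → ℤ) → (∀ y → Δ[ + 1 ] h y ≈ s y) → (∀ y c → s y ≈ s (y + c)) →
             ∀ c y → Δ[ c ] h y ≈ c * s y
  Δ-affine h s Δh≈s s-const (+ n) y = Δ-pos n
    where
    open ≈-Reasoning
    Δ-pos : ∀ n → Δ[ + n ] h y ≈ + n * s y
    Δ-pos zero = begin
      h y - h (y + + 0) ≡⟨ cong (λ t → h y - h t) (+-identityʳ y) ⟩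
      h y - h y         ≡⟨ +-inverseʳ (h y) ⟩
      + 0               ≡⟨ *-zeroˡ (s y) ⟨
      + 0 * s y         ∎
    Δ-pos (suc n) = begin
      h y - h (y + + suc n)                             ≡⟨ cong (λ t → h y - h t) (step y (+ n)) ⟩
      h y - h (y + + n + + 1)                           ≡⟨ telescope (h y) (h (y + + n)) (h (y + + n + + 1)) ⟩
      Δ[ + n ] h y + Δ[ + 1 ] h (y + + n)               ≈⟨ +-cong (Δ-pos n) (Δh≈s (y + + n)) ⟩
      + n * s y + s (y + + n)                           ≈⟨ +-congˡ (+ n * s y) (≈-sym (s-const y (+ n))) ⟩
      + n * s y + s y                                   ≡⟨ collect (+ n) (s y) ⟩
      + suc n * s y                                     ∎
      where
      step : ∀ y n → y + (+ 1 + n) ≡ y + n + + 1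
      step = solve-∀
      telescope : ∀ a b c → a - c ≡ (a - b) + (b - c)
      telescope = solve-∀
      collect : ∀ n x → n * x + x ≡ (+ 1 + n) * x
      collect = solve-∀
  Δ-affine h s Δh≈s s-const -[1+ n ] y = begin
    h y - h y′                    ≡⟨ cong (λ t → h t - h y′) (back-and-forth y n′) ⟨
    h (y′ + n′) - h y′            ≡⟨ flip (h (y′ + n′)) (h y′) ⟩
    - Δ[ n′ ] h y′                ≈⟨ -‿cong (Δ-affine h s Δh≈s s-const n′ y′) ⟩
    - (n′ * s y′)                 ≈⟨ -‿cong (*-congˡ n′ (≈-trans (s-const y′ n′) (≡⇒≈ (cong s (back-and-forth y n′))))) ⟩
    - (n′ * s y)                  ≡⟨ neg-distribˡ-* n′ (s y) ⟩
    - n′ * s y                    ∎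
    where
    open ≈-Reasoning
    n′ = + suc n
    y′ = y + - n′
    back-and-forth : ∀ y n → y + - n + n ≡ y
    back-and-forth = solve-∀
    flip : ∀ a b → a - b ≡ - (b - a)
    flip = solve-∀

  Δ₁≈0⇒periodic : ∀ (f : ℤ → ℤ) → (∀ y → Δ[ + 1 ] f y ≈ + 0) → ∀ y c → f y ≈ f (y + c)
  Δ₁≈0⇒periodic f Δf≈0 y c =
    -≈0⇒≈ (≈-trans (Δ-affine f (λ _ → + 0) Δf≈0 (λ _ _ → ≈-refl) c y) (≡⇒≈ (*-zeroʳ c)))

  esymΔ≈esym*Δ^ : ∀ N k cs (g : ℤ → ℤ) → (∀ y → Δ^ (suc k) g y ≈ + 0) →
                  ∀ y → esymΔ N k cs g y ≈ esym N k cs * Δ^ k g y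
  esymΔ≈esym*Δ^ N zero cs g _ y = ≡⇒≈ (sym (*-identityˡ (g y)))
  esymΔ≈esym*Δ^ zero (suc k) cs g _ y = ≈-refl
  esymΔ≈esym*Δ^ (suc N) (suc k) cs g Δ^g≈0 y = begin
    esymΔ N (suc k) cs' g y + esymΔ N k cs' (Δ[ c ] g) y
      ≈⟨ +-cong (esymΔ≈esym*Δ^ N (suc k) cs' g Δ^g≈0 y) (esymΔ≈esym*Δ^ N k cs' (Δ[ c ] g) Δ^Δg≈0 y) ⟩
    esym N (suc k) cs' * u + esym N k cs' * Δ^ k (Δ[ c ] g) y
      ≡⟨ cong (λ t → esym N (suc k) cs' * u + esym N k cs' * t) (ΔΠ-Δ k (λ _ → + 1) c g y) ⟩
    esym N (suc k) cs' * u + esym N k cs' * Δ[ c ] (Δ^ k g) y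
      ≈⟨ +-congˡ (esym N (suc k) cs' * u) (*-congˡ (esym N k cs') Δ[c]Δ^g) ⟩
    esym N (suc k) cs' * u + esym N k cs' * (c * u)
      ≡⟨ collect (esym N (suc k) cs') (esym N k cs') c u ⟩
    (esym N (suc k) cs' + c * esym N k cs') * u ∎
    where
    open ≈-Reasoning
    cs' = tail cs
    c = head cs
    u = Δ^ (suc k) g y
    Δ^g-periodic : ∀ y c → Δ^ (suc k) g y ≈ Δ^ (suc k) g (y + c)
    Δ^g-periodic = Δ₁≈0⇒periodic (Δ^ (suc k) g) (λ y → ≈-trans (≡⇒≈ (sym (Δ^-suc (suc k) g y))) (Δ^g≈0 y))
    Δ^Δg≈0 : ∀ y → Δ^ (suc k) (Δ[ c ] g) y ≈ + 0
    Δ^Δg≈0 y = ≈-trans (≡⇒≈ (ΔΠ-Δ (suc k) (λ _ → + 1) c g y)) (≈⇒-≈0 (Δ^g-periodic y c))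
    Δ[c]Δ^g : Δ[ c ] (Δ^ k g) y ≈ c * u
    Δ[c]Δ^g = Δ-affine (Δ^ k g) (Δ^ (suc k) g) (λ y → ≡⇒≈ (sym (Δ^-suc k g y))) Δ^g-periodic c y
    collect : ∀ a b c u → a * u + b * (c * u) ≡ (a + c * b) * u
    collect = solve-∀

[1+k]*[1+n]C[1+k]≡[1+n]*nCk : ∀ n k → suc k ℕ.* (suc n C suc k) ≡ suc n ℕ.* (n C k)
[1+k]*[1+n]C[1+k]≡[1+n]*nCk zero zero = refl
[1+k]*[1+n]C[1+k]≡[1+n]*nCk zero (suc k) = ℕ.*-zeroʳ (2 ℕ.+ k)
[1+k]*[1+n]C[1+k]≡[1+n]*nCk (suc n) zero =
  trans (ℕ.*-identityˡ _) (trans (nC1≡n (2 ℕ.+ n)) (sym (ℕ.*-identityʳ (2 ℕ.+ n))))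
[1+k]*[1+n]C[1+k]≡[1+n]*nCk (suc n) (suc k) = begin
  (2 ℕ.+ k) ℕ.* ((2 ℕ.+ n) C (2 ℕ.+ k))
    ≡⟨ cong ((2 ℕ.+ k) ℕ.*_) (trans (sym (nCk+nC[k+1]≡[n+1]C[k+1] (suc n) (suc k)))
                                     (cong₂ ℕ._+_ (sym (nCk+nC[k+1]≡[n+1]C[k+1] n k))
                                                  (sym (nCk+nC[k+1]≡[n+1]C[k+1] n (suc k))))) ⟩
  (2 ℕ.+ k) ℕ.* ((X ℕ.+ Y) ℕ.+ (Y ℕ.+ Z))
    ≡⟨ split k X Y Z ⟩
  (X ℕ.+ Y) ℕ.+ ((1 ℕ.+ k) ℕ.* (X ℕ.+ Y) ℕ.+ (2 ℕ.+ k) ℕ.* (Y ℕ.+ Z))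
    ≡⟨ cong₂ (λ u v → (X ℕ.+ Y) ℕ.+ (u ℕ.+ v))
             (trans (cong (suc k ℕ.*_) (nCk+nC[k+1]≡[n+1]C[k+1] n k)) ([1+k]*[1+n]C[1+k]≡[1+n]*nCk n k))
             (trans (cong ((2 ℕ.+ k) ℕ.*_) (nCk+nC[k+1]≡[n+1]C[k+1] n (suc k))) ([1+k]*[1+n]C[1+k]≡[1+n]*nCk n (suc k))) ⟩
  (X ℕ.+ Y) ℕ.+ ((1 ℕ.+ n) ℕ.* X ℕ.+ (1 ℕ.+ n) ℕ.* Y)
    ≡⟨ merge n X Y ⟩
  (2 ℕ.+ n) ℕ.* (X ℕ.+ Y)
    ≡⟨ cong ((2 ℕ.+ n) ℕ.*_) (nCk+nC[k+1]≡[n+1]C[k+1] n k) ⟩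
  (2 ℕ.+ n) ℕ.* (suc n C suc k) ∎
  where
  open ≡-Reasoning
  X = n C k
  Y = n C suc k
  Z = n C (2 ℕ.+ k)
  split : ∀ k X Y Z → (2 ℕ.+ k) ℕ.* ((X ℕ.+ Y) ℕ.+ (Y ℕ.+ Z))
                    ≡ (X ℕ.+ Y) ℕ.+ ((1 ℕ.+ k) ℕ.* (X ℕ.+ Y) ℕ.+ (2 ℕ.+ k) ℕ.* (Y ℕ.+ Z))
  split = ℕ-solve-∀
  merge : ∀ n X Y → (X ℕ.+ Y) ℕ.+ ((1 ℕ.+ n) ℕ.* X ℕ.+ (1 ℕ.+ n) ℕ.* Y) ≡ (2 ℕ.+ n) ℕ.* (X ℕ.+ Y)
  merge = ℕ-solve-∀

[1+k]*[a+k]C[1+k]≡a*[a+k]Ck : ∀ a k → suc k ℕ.* ((a ℕ.+ k) C suc k) ≡ a ℕ.* ((a ℕ.+ k) C k)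
[1+k]*[a+k]C[1+k]≡a*[a+k]Ck a k = ℕ.+-cancelˡ-≡ (suc k ℕ.* B) _ _ (begin
  suc k ℕ.* B ℕ.+ suc k ℕ.* B′     ≡⟨ ℕ.*-distribˡ-+ (suc k) B B′ ⟨
  suc k ℕ.* (B ℕ.+ B′)             ≡⟨ cong (suc k ℕ.*_) (nCk+nC[k+1]≡[n+1]C[k+1] (a ℕ.+ k) k) ⟩
  suc k ℕ.* (suc (a ℕ.+ k) C suc k) ≡⟨ [1+k]*[1+n]C[1+k]≡[1+n]*nCk (a ℕ.+ k) k ⟩
  suc (a ℕ.+ k) ℕ.* B              ≡⟨ cong (ℕ._* B) (trans (sym (ℕ.+-suc a k)) (ℕ.+-comm a (suc k))) ⟩
  (suc k ℕ.+ a) ℕ.* B              ≡⟨ ℕ.*-distribʳ-+ B (suc k) a ⟩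
  suc k ℕ.* B ℕ.+ a ℕ.* B          ∎)
  where
  open ≡-Reasoning
  B = (a ℕ.+ k) C k
  B′ = (a ℕ.+ k) C suc k

module _ {p : ℕ} (p-prime : Prime p) where

  private instance
    p≢0 : ℕ.NonZero p
    p≢0 = prime⇒nonZero p-prime

  p^h∣m*n∧p^h∤m⇒p∣n : ∀ h m n → p ^ h ℕ.∣ m ℕ.* n → ¬ p ^ h ℕ.∣ m → p ℕ.∣ n
  p^h∣m*n∧p^h∤m⇒p∣n zero m n _ 1∤m = contradiction (ℕ.1∣ m) 1∤m
  p^h∣m*n∧p^h∤m⇒p∣n (suc h) m n p^[1+h]∣m*n p^[1+h]∤m
    with euclidsLemma m n p-prime (ℕ.∣-trans (ℕ.m∣m*n (p ^ h)) p^[1+h]∣m*n)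
  ... | inj₂ p∣n = p∣n
  ... | inj₁ (ℕ.divides q refl) = p^h∣m*n∧p^h∤m⇒p∣n h q n p^h∣q*n p^h∤q
    where
    reassoc : ∀ q p n → q ℕ.* p ℕ.* n ≡ p ℕ.* (q ℕ.* n)
    reassoc = ℕ-solve-∀
    p^h∣q*n : p ^ h ℕ.∣ q ℕ.* n
    p^h∣q*n = ℕ.*-cancelˡ-∣ p (subst (p ℕ.* p ^ h ℕ.∣_) (reassoc q p n) p^[1+h]∣m*n)
    p^h∤q : ¬ p ^ h ℕ.∣ q
    p^h∤q p^h∣q = p^[1+h]∤m (subst (p ℕ.* p ^ h ℕ.∣_) (ℕ.*-comm p q) (ℕ.*-monoʳ-∣ p p^h∣q))

  p∣mCj : ∀ h m j → p ^ h ℕ.∣ m → ¬ p ^ h ℕ.∣ j → p ℕ.∣ m C j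
  p∣mCj h m zero _ p^h∤0 = contradiction ((p ^ h) ℕ.∣0) p^h∤0
  p∣mCj h zero (suc k) _ _ = p ℕ.∣0
  p∣mCj h (suc n) (suc k) p^h∣m p^h∤j = p^h∣m*n∧p^h∤m⇒p∣n h (suc k) (suc n C suc k)
    (subst (p ^ h ℕ.∣_) (sym ([1+k]*[1+n]C[1+k]≡[1+n]*nCk n k)) (ℕ.∣-trans p^h∣m (ℕ.m∣m*n (n C k))))
    p^h∤j

  p∣[m+i]C[1+i] : ∀ h m i → p ^ h ℕ.∣ m → ¬ p ^ h ℕ.∣ suc i → p ℕ.∣ (m ℕ.+ i) C suc i
  p∣[m+i]C[1+i] h m i p^h∣m p^h∤1+i = p^h∣m*n∧p^h∤m⇒p∣n h (suc i) ((m ℕ.+ i) C suc i)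
    (subst (p ^ h ℕ.∣_) (sym ([1+k]*[a+k]C[1+k]≡a*[a+k]Ck m i)) (ℕ.∣-trans p^h∣m (ℕ.m∣m*n ((m ℕ.+ i) C i))))
    p^h∤1+i

sumℤ-++ : ∀ xs ys → sumℤ (xs ++ ys) ≡ sumℤ xs + sumℤ ys
sumℤ-++ [] ys = sym (+-identityˡ (sumℤ ys))
sumℤ-++ (x ∷ xs) ys = trans (cong (_+_ x) (sumℤ-++ xs ys)) (sym (+-assoc x (sumℤ xs) (sumℤ ys)))

sumℤ-neg : ∀ {A : Set} (f : A → ℤ) xs → sumℤ (map (λ x → - f x) xs) ≡ - sumℤ (map f xs)
sumℤ-neg f [] = refl
sumℤ-neg f (x ∷ xs) = trans (cong (_+_ (- f x)) (sumℤ-neg f xs)) (sym (neg-distrib-+ (f x) (sumℤ (map f xs))))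

sumℤ-allSubsets-suc : ∀ n (f : Subset (suc n) → ℤ) →
  sumℤ (map f (allSubsets (suc n)))
    ≡ sumℤ (map (f ∘ (outside ∷_)) (allSubsets n)) + sumℤ (map (f ∘ (inside ∷_)) (allSubsets n))
sumℤ-allSubsets-suc n f = begin
  sumℤ (map f (map (outside ∷_) A ++ map (inside ∷_) A))
    ≡⟨ cong sumℤ (map-++ f (map (outside ∷_) A) (map (inside ∷_) A)) ⟩
  sumℤ (map f (map (outside ∷_) A) ++ map f (map (inside ∷_) A))
    ≡⟨ sumℤ-++ (map f (map (outside ∷_) A)) _ ⟩
  sumℤ (map f (map (outside ∷_) A)) + sumℤ (map f (map (inside ∷_) A))
    ≡⟨ cong₂ _+_ (cong sumℤ (map-∘ A)) (cong sumℤ (map-∘ A)) ⟨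
  sumℤ (map (f ∘ (outside ∷_)) A) + sumℤ (map (f ∘ (inside ∷_)) A) ∎
  where
  open ≡-Reasoning
  A = allSubsets n

sum-allSubsets-suc : ∀ n (f : Subset (suc n) → ℕ) →
  sum (map f (allSubsets (suc n)))
    ≡ sum (map (f ∘ (outside ∷_)) (allSubsets n)) ℕ.+ sum (map (f ∘ (inside ∷_)) (allSubsets n))
sum-allSubsets-suc n f = begin
  sum (map f (map (outside ∷_) A ++ map (inside ∷_) A))
    ≡⟨ cong sum (map-++ f (map (outside ∷_) A) (map (inside ∷_) A)) ⟩
  sum (map f (map (outside ∷_) A) ++ map f (map (inside ∷_) A))
    ≡⟨ sum-++ (map f (map (outside ∷_) A)) _ ⟩
  sum (map f (map (outside ∷_) A)) ℕ.+ sum (map f (map (inside ∷_) A))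
    ≡⟨ cong₂ ℕ._+_ (cong sum (map-∘ A)) (cong sum (map-∘ A)) ⟨
  sum (map (f ∘ (outside ∷_)) A) ℕ.+ sum (map (f ∘ (inside ∷_)) A) ∎
  where
  open ≡-Reasoning
  A = allSubsets n

sum-map-0 : ∀ {A : Set} (xs : List A) → sum (map (λ _ → 0) xs) ≡ 0
sum-map-0 [] = refl
sum-map-0 (x ∷ xs) = sum-map-0 xs

signed-subset-sum≡ΔΠ : ∀ n cs (g : ℤ → ℤ) y →
  sumℤ (map (λ I → sign (card I) * g (subsetSum cs I + y)) (allSubsets n)) ≡ ΔΠ n cs g y
signed-subset-sum≡ΔΠ zero cs g y = trans (+-identityʳ _) (trans (*-identityˡ _) (cong g (+-identityˡ y)))
signed-subset-sum≡ΔΠ (suc n) cs g y = begin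
  sumℤ (map term (allSubsets (suc n)))
    ≡⟨ sumℤ-allSubsets-suc n term ⟩
  sumℤ (map (term ∘ (outside ∷_)) A) + sumℤ (map (term ∘ (inside ∷_)) A)
    ≡⟨ cong₂ _+_ (signed-subset-sum≡ΔΠ n cs' g y) (cong sumℤ (map-cong inside-term A)) ⟩
  ΔΠ n cs' g y + sumℤ (map (λ I → - term′ I) A)
    ≡⟨ cong (_+_ (ΔΠ n cs' g y)) (trans (sumℤ-neg term′ A) (cong -_ (signed-subset-sum≡ΔΠ n cs' g (y + c)))) ⟩
  Δ[ c ] (ΔΠ n cs' g) y
    ≡⟨ ΔΠ-Δ n cs' c g y ⟨
  ΔΠ n cs' (Δ[ c ] g) y ∎
  where
  open ≡-Reasoning
  A = allSubsets n
  cs' = tail cs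
  c = head cs
  term : Subset (suc n) → ℤ
  term I = sign (card I) * g (subsetSum cs I + y)
  term′ : Subset n → ℤ
  term′ I = sign (card I) * g (subsetSum cs' I + (y + c))
  regroup : ∀ c s y → c + s + y ≡ s + (y + c)
  regroup = solve-∀
  inside-term : ∀ I → term (inside ∷ I) ≡ - term′ I
  inside-term I = trans (cong (λ t → - sign (card I) * g t) (regroup c (subsetSum cs' I) y))
                        (sym (neg-distribˡ-* (sign (card I)) _))

indicator : ℕ → ℤ → ℤ
indicator m z = if divides? m z then + 1 else + 0

signedSum≡ΔΠ : ∀ m n c cs → signedSum m n c cs ≡ ΔΠ n cs (indicator m) (- c)
signedSum≡ΔΠ m n c cs =
  trans (cong sumℤ (map-cong (λ I → if-then-else-0 (divides? m (subsetSum cs I - c)) (sign (card I))) (allSubsets n)))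
        (signed-subset-sum≡ΔΠ n cs (indicator m) (- c))
  where
  if-then-else-0 : ∀ b s → (if b then s else + 0) ≡ s * (if b then + 1 else + 0)
  if-then-else-0 true s = sym (*-identityʳ s)
  if-then-else-0 false s = sym (*-zeroʳ s)

-- countSubsets m N k c cs is countShifted m N k cs (- c) by definition.
countShifted : (m N k : ℕ) → Vector ℤ N → ℤ → ℕ
countShifted m N k cs y =
  sum (map (λ I → if ⌊ card I ℕ.≟ k ⌋ ∧ divides? m (subsetSum cs I + y) then 1 else 0) (allSubsets N))

countShifted≡esymShift : ∀ m N k cs y → + countShifted m N k cs y ≡ esymShift N k cs (indicator m) y
countShifted≡esymShift m zero zero cs y =
  trans (cong +_ (ℕ.+-identityʳ _)) (trans (cast (divides? m (+ 0 + y))) (cong (indicator m) (+-identityˡ y)))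
  where
  cast : ∀ b → + (if b then 1 else 0) ≡ (if b then + 1 else + 0)
  cast true = refl
  cast false = refl
countShifted≡esymShift m zero (suc k) cs y = refl
countShifted≡esymShift m (suc N) zero cs y = begin
  + countShifted m (suc N) zero cs y
    ≡⟨ cong +_ (sum-allSubsets-suc N _) ⟩
  + (countShifted m N zero (tail cs) y ℕ.+ sum (map (λ _ → 0) (allSubsets N)))
    ≡⟨ cong (λ t → + (countShifted m N zero (tail cs) y ℕ.+ t)) (sum-map-0 (allSubsets N)) ⟩
  + (countShifted m N zero (tail cs) y ℕ.+ 0)
    ≡⟨ cong +_ (ℕ.+-identityʳ _) ⟩
  + countShifted m N zero (tail cs) y
    ≡⟨ countShifted≡esymShift m N zero (tail cs) y ⟩
  indicator m y ∎
  where open ≡-Reasoning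
countShifted≡esymShift m (suc N) (suc k) cs y = begin
  + countShifted m (suc N) (suc k) cs y
    ≡⟨ cong +_ (sum-allSubsets-suc N _) ⟩
  + (countShifted m N (suc k) cs' y ℕ.+ sum (map inside-term (allSubsets N)))
    ≡⟨ cong (λ t → + (countShifted m N (suc k) cs' y ℕ.+ sum t)) (map-cong inside-term≡ (allSubsets N)) ⟩
  + (countShifted m N (suc k) cs' y ℕ.+ countShifted m N k cs' (y + c))
    ≡⟨ pos-+ (countShifted m N (suc k) cs' y) (countShifted m N k cs' (y + c)) ⟩
  + countShifted m N (suc k) cs' y + + countShifted m N k cs' (y + c)
    ≡⟨ cong₂ _+_ (countShifted≡esymShift m N (suc k) cs' y) (countShifted≡esymShift m N k cs' (y + c)) ⟩
  esymShift N (suc k) cs' (indicator m) y + esymShift N k cs' (indicator m) (y + c) ∎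
  where
  open ≡-Reasoning
  cs' = tail cs
  c = head cs
  inside-term : Subset N → ℕ
  inside-term I = if ⌊ suc (card I) ℕ.≟ suc k ⌋ ∧ divides? m (c + subsetSum cs' I + y) then 1 else 0
  regroup : ∀ c s y → c + s + y ≡ s + (y + c)
  regroup = solve-∀
  inside-term≡ : ∀ I → inside-term I ≡ (if ⌊ card I ℕ.≟ k ⌋ ∧ divides? m (subsetSum cs' I + (y + c)) then 1 else 0)
  inside-term≡ I = cong₂ (λ b z → if b ∧ divides? m z then 1 else 0)
                         (trans (⌊⌋-map′ _ _ _) (sym (⌊⌋-map′ _ _ _))) (regroup c (subsetSum cs' I) y)

x-a*0≡x : ∀ x a → x - a * + 0 ≡ x
x-a*0≡x x a = trans (cong (λ t → x - t) (*-zeroʳ a)) (+-identityʳ x)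

coeff-mulLinearGo : ∀ a q qs j → coeff j (mulLinearGo a q qs) ≡ coeff j (q ∷ qs) - a * coeff j qs
coeff-mulLinearGo a q [] zero = sym (x-a*0≡x q a)
coeff-mulLinearGo a q [] (suc j) = sym (x-a*0≡x (+ 0) a)
coeff-mulLinearGo a q (q′ ∷ qs) zero = refl
coeff-mulLinearGo a q (q′ ∷ qs) (suc j) = coeff-mulLinearGo a q′ qs j

coeff-mulLinear : ∀ a Q j → coeff j (mulLinear a Q) ≡ coeff j (+ 0 ∷ Q) - a * coeff j Q
coeff-mulLinear a [] zero = sym (x-a*0≡x (+ 0) a)
coeff-mulLinear a [] (suc j) = sym (x-a*0≡x (+ 0) a)
coeff-mulLinear a (q ∷ qs) zero = sym (+-identityˡ (- (a * q)))
coeff-mulLinear a (q ∷ qs) (suc j) = coeff-mulLinearGo a q qs j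

coeff-linProd-above : ∀ N cs j → N ℕ.< j → coeff j (linProd N cs) ≡ + 0
coeff-linProd-above zero cs (suc zero) _ = refl
coeff-linProd-above zero cs (suc (suc j)) _ = refl
coeff-linProd-above (suc N) cs (suc j) (s≤s N<j) = begin
  coeff (suc j) (mulLinear (head cs) Q)          ≡⟨ coeff-mulLinear (head cs) Q (suc j) ⟩
  coeff j Q - head cs * coeff (suc j) Q           ≡⟨ cong₂ (λ u v → u - head cs * v)
                                                       (coeff-linProd-above N (tail cs) j N<j)
                                                       (coeff-linProd-above N (tail cs) (suc j) (ℕ.m<n⇒m<1+n N<j)) ⟩
  + 0 - head cs * + 0                             ≡⟨ x-a*0≡x (+ 0) (head cs) ⟩
  + 0                                             ∎
  where
  open ≡-Reasoning
  Q = linProd N (tail cs)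

coeff-linProd : ∀ N cs j k → j ℕ.+ k ≡ N → coeff j (linProd N cs) ≡ sign k * esym N k cs
coeff-linProd zero cs zero zero refl = refl
coeff-linProd (suc N) cs zero .(suc N) refl = begin
  coeff 0 (mulLinear c Q)                          ≡⟨ coeff-mulLinear c Q 0 ⟩
  + 0 - c * coeff 0 Q                              ≡⟨ cong (λ t → + 0 - c * t) (coeff-linProd N cs' 0 N refl) ⟩
  + 0 - c * (sign N * esym N N cs')                ≡⟨ factor c (sign N) (esym N N cs') ⟩
  - sign N * (+ 0 + c * esym N N cs')              ≡⟨ cong (λ t → - sign N * (t + c * esym N N cs')) (esym-vanish N (suc N) cs' ℕ.≤-refl) ⟨
  - sign N * (esym N (suc N) cs' + c * esym N N cs') ∎
  where
  open ≡-Reasoning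
  c = head cs
  cs' = tail cs
  Q = linProd N cs'
  factor : ∀ c s x → + 0 - c * (s * x) ≡ - s * (+ 0 + c * x)
  factor = solve-∀
coeff-linProd (suc N) cs (suc j) zero 1+j+0≡1+N = begin
  coeff (suc j) (mulLinear c Q)                   ≡⟨ coeff-mulLinear c Q (suc j) ⟩
  coeff j Q - c * coeff (suc j) Q                 ≡⟨ cong₂ (λ u v → u - c * v) (coeff-linProd N cs' j 0 j+0≡N)
                                                       (coeff-linProd-above N cs' (suc j) (s≤s (ℕ.≤-reflexive (sym j≡N)))) ⟩
  + 1 - c * + 0                                   ≡⟨ x-a*0≡x (+ 1) c ⟩
  + 1                                             ∎
  where
  open ≡-Reasoning
  c = head cs
  cs' = tail cs
  Q = linProd N cs'
  j+0≡N : j ℕ.+ 0 ≡ N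
  j+0≡N = ℕ.suc-injective 1+j+0≡1+N
  j≡N : j ≡ N
  j≡N = trans (sym (ℕ.+-identityʳ j)) j+0≡N
coeff-linProd (suc N) cs (suc j) (suc k) 1+j+1+k≡1+N = begin
  coeff (suc j) (mulLinear c Q)                   ≡⟨ coeff-mulLinear c Q (suc j) ⟩
  coeff j Q - c * coeff (suc j) Q                 ≡⟨ cong₂ (λ u v → u - c * v) (coeff-linProd N cs' j (suc k) j+1+k≡N)
                                                       (coeff-linProd N cs' (suc j) k (trans (sym (ℕ.+-suc j k)) j+1+k≡N)) ⟩
  - sign k * esym N (suc k) cs' - c * (sign k * esym N k cs')
                                                  ≡⟨ factor c (sign k) (esym N (suc k) cs') (esym N k cs') ⟩
  - sign k * (esym N (suc k) cs' + c * esym N k cs') ∎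
  where
  open ≡-Reasoning
  c = head cs
  cs' = tail cs
  Q = linProd N cs'
  j+1+k≡N : j ℕ.+ suc k ≡ N
  j+1+k≡N = ℕ.suc-injective 1+j+1+k≡1+N
  factor : ∀ c s y x → - s * y - c * (s * x) ≡ - s * (y + c * x)
  factor = solve-∀

sign*sign≡1 : ∀ n → sign n * sign n ≡ + 1
sign*sign≡1 zero = refl
sign*sign≡1 (suc n) = trans (neg*neg (sign n)) (sign*sign≡1 n)
  where
  neg*neg : ∀ s → - s * - s ≡ s * s
  neg*neg = solve-∀

0<j<m⇒m∤j : ∀ {m j} → 0 ℕ.< j → j ℕ.< m → ¬ m ℕ.∣ j
0<j<m⇒m∤j {j = suc j} _ j<m m∣j = ℕ.<⇒≱ j<m (ℕ.∣⇒≤ m∣j)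

divides?-periodic : ∀ m k y → m ℕ.∣ k → divides? m (y + + k) ≡ divides? m y
divides?-periodic m k y m∣k =
  trans (isYes≗does (m ℕ.∣? ∣ y + + k ∣)) (trans (does-⇔ (mk⇔ to from) (m ℕ.∣? ∣ y + + k ∣) (m ℕ.∣? ∣ y ∣)) (sym (isYes≗does (m ℕ.∣? ∣ y ∣))))
  where
  to : m ℕ.∣ ∣ y + + k ∣ → m ℕ.∣ ∣ y ∣
  to m∣y+k = ∣⇒∣ᵤ {+ m} {y} (∣m+n∣n⇒∣m (∣ᵤ⇒∣ {+ m} {y + + k} m∣y+k) (∣ᵤ⇒∣ {+ m} {+ k} m∣k))
  from : m ℕ.∣ ∣ y ∣ → m ℕ.∣ ∣ y + + k ∣
  from m∣y = ∣⇒∣ᵤ {+ m} {y + + k} (∣m∣n⇒∣m+n (∣ᵤ⇒∣ {+ m} {y} m∣y) (∣ᵤ⇒∣ {+ m} {+ k} m∣k))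

indicator-0 : ∀ m → indicator m (+ 0) ≡ + 1
indicator-0 m = cong (if_then + 1 else + 0) (trans (isYes≗does (m ℕ.∣? 0)) (dec-true (m ℕ.∣? 0) (m ℕ.∣0)))

indicator-nondivisible : ∀ m j → ¬ m ℕ.∣ j → indicator m (+ j) ≡ + 0
indicator-nondivisible m j m∤j = cong (if_then + 1 else + 0) (trans (isYes≗does (m ℕ.∣? j)) (dec-false (m ℕ.∣? j) m∤j))

n+n∸j≡1+n+[n∸1+j] : ∀ {n j} → j ℕ.< n → n ℕ.+ n ∸ j ≡ suc n ℕ.+ (n ∸ suc j)
n+n∸j≡1+n+[n∸1+j] {n} {j} j<n = begin
  n ℕ.+ n ∸ j           ≡⟨ ℕ.+-∸-assoc n (ℕ.<⇒≤ j<n) ⟩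
  n ℕ.+ (n ∸ j)         ≡⟨ cong (n ℕ.+_) (ℕ.+-∸-assoc 1 j<n) ⟩
  n ℕ.+ suc (n ∸ suc j) ≡⟨ ℕ.+-suc n (n ∸ suc j) ⟩
  suc n ℕ.+ (n ∸ suc j) ∎
  where open ≡-Reasoning

module PrimePower {p : ℕ} (p-prime : Prime p) (h n : ℕ) (p^h≡1+n : p ^ h ≡ suc n) where

  open Congruence (+ p)

  p^h∤j : ∀ {j} → 0 ℕ.< j → j ℕ.< suc n → ¬ p ^ h ℕ.∣ j
  p^h∤j 0<j j<1+n = 0<j<m⇒m∤j 0<j (subst (_ ℕ.<_) (sym p^h≡1+n) j<1+n)

  p∣⇒≈0 : ∀ {x} → p ℕ.∣ x → + x ≈ + 0
  p∣⇒≈0 {x} p∣x = ∣⇒≈0 (∣ᵤ⇒∣ {+ p} {+ x} p∣x)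

  Δ^[1+n]≈ends : ∀ (g : ℤ → ℤ) y → Δ^ (suc n) g y ≈ g y + sign (suc n) * g (y + + suc n)
  Δ^[1+n]≈ends g y = begin
    Δ^ m g y                                                   ≡⟨ ΔΠ≡esymΔ m (λ _ → + 1) g y ⟩
    esymΔ m m (λ _ → + 1) g y                                  ≡⟨ esymΔ-expansion m m (λ _ → + 1) g y ⟩
    sumUpTo m (λ j → sign j * + ((m ∸ j) C (m ∸ j)) * esymShift m j (λ _ → + 1) g y)
                                                               ≡⟨ sumUpTo-cong m (λ j _ → binomial-term j) ⟩
    sumUpTo m a                                                ≈⟨ sumUpTo-≈ends n a middle≈0 ⟩
    a 0 + a m                                                  ≡⟨ cong₂ _+_ a0≡ am≡ ⟩
    g y + sign m * g (y + + m)                                 ∎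
    where
    open ≈-Reasoning
    m = suc n
    a : ℕ → ℤ
    a j = sign j * (+ (m C j) * g (y + + j))
    binomial-term : ∀ j → sign j * + ((m ∸ j) C (m ∸ j)) * esymShift m j (λ _ → + 1) g y ≡ a j
    binomial-term j = trans (cong₂ (λ k t → sign j * + k * t) (nCn≡1 (m ∸ j)) (esymShift-const m j g y))
                            (cong (_* (+ (m C j) * g (y + + j))) (*-identityʳ (sign j)))
    a0≡ : a 0 ≡ g y
    a0≡ = trans (*-identityˡ _) (trans (*-identityˡ _) (cong g (+-identityʳ y)))
    am≡ : a m ≡ sign m * g (y + + m)
    am≡ = cong (sign m *_) (trans (cong (λ k → + k * g (y + + m)) (nCn≡1 m)) (*-identityˡ _))
    middle≈0 : ∀ j → 0 ℕ.< j → j ℕ.< suc n → a j ≈ + 0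
    middle≈0 j 0<j j<m = ≈-trans (*-congˡ (sign j) (*-cong (p∣⇒≈0 p∣[1+n]Cj) (≈-refl {g (y + + j)})))
                                 (≡⇒≈ (trans (cong (sign j *_) (*-zeroˡ (g (y + + j)))) (*-zeroʳ (sign j))))
      where
      p∣[1+n]Cj : p ℕ.∣ m C j
      p∣[1+n]Cj = p∣mCj p-prime h m j (ℕ.∣-reflexive p^h≡1+n) (p^h∤j 0<j j<m)

  1+sign[1+n]≈0 : + 1 + sign (suc n) ≈ + 0
  1+sign[1+n]≈0 = begin
    + 1 + sign (suc n)                 ≡⟨ cong (_+_ (+ 1)) (*-identityʳ (sign (suc n))) ⟨
    + 1 + sign (suc n) * + 1           ≈⟨ Δ^[1+n]≈ends (λ _ → + 1) (+ 0) ⟨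
    Δ^ (suc n) (λ _ → + 1) (+ 0)       ≡⟨ Δ^-zero n (+ 0) ⟩
    + 0                                ∎
    where open ≈-Reasoning

  Δ^[1+n]-indicator≈0 : ∀ y → Δ^ (suc n) (indicator (p ^ h)) y ≈ + 0
  Δ^[1+n]-indicator≈0 y = begin
    Δ^ (suc n) χ y                     ≈⟨ Δ^[1+n]≈ends χ y ⟩
    χ y + sign (suc n) * χ (y + + suc n)
      ≡⟨ cong (λ b → χ y + sign (suc n) * (if b then + 1 else + 0))
              (divides?-periodic (p ^ h) (suc n) y (ℕ.∣-reflexive p^h≡1+n)) ⟩
    χ y + sign (suc n) * χ y           ≡⟨ factor (χ y) (sign (suc n)) ⟩
    χ y * (+ 1 + sign (suc n))         ≈⟨ *-congˡ (χ y) 1+sign[1+n]≈0 ⟩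
    χ y * + 0                          ≡⟨ *-zeroʳ (χ y) ⟩
    + 0                                ∎
    where
    open ≈-Reasoning
    χ = indicator (p ^ h)
    factor : ∀ x s → x + s * x ≡ x * (+ 1 + s)
    factor = solve-∀

  Δ^n-indicator≈1 : ∀ y → Δ^ n (indicator (p ^ h)) y ≈ + 1
  Δ^n-indicator≈1 y = ≈-sym (begin
    + 1                      ≡⟨ indicator-0 (p ^ h) ⟨
    χ (+ 0)                  ≡⟨ Δ^-vanishing n χ (+ 0) χ-vanishes ⟨
    Δ^ n χ (+ 0)             ≈⟨ Δ₁≈0⇒periodic (Δ^ n χ) Δ₁Δ^nχ≈0 (+ 0) y ⟩
    Δ^ n χ (+ 0 + y)         ≡⟨ cong (Δ^ n χ) (+-identityˡ y) ⟩
    Δ^ n χ y                 ∎)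
    where
    open ≈-Reasoning
    χ = indicator (p ^ h)
    χ-vanishes : ∀ j → 1 ℕ.≤ j → j ℕ.≤ n → χ (+ 0 + + j) ≡ + 0
    χ-vanishes j 1≤j j≤n = indicator-nondivisible (p ^ h) j (p^h∤j 1≤j (s≤s j≤n))
    Δ₁Δ^nχ≈0 : ∀ z → Δ[ + 1 ] (Δ^ n χ) z ≈ + 0
    Δ₁Δ^nχ≈0 z = ≈-trans (≡⇒≈ (sym (Δ^-suc n χ z))) (Δ^[1+n]-indicator≈0 z)

  signedSum≈prodℤ : ∀ c cs → signedSum (p ^ h) n c cs ≈ prodℤ n cs
  signedSum≈prodℤ c cs = begin
    signedSum (p ^ h) n c cs               ≡⟨ signedSum≡ΔΠ (p ^ h) n c cs ⟩
    ΔΠ n cs χ (- c)                        ≡⟨ ΔΠ≡esymΔ n cs χ (- c) ⟩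
    esymΔ n n cs χ (- c)                   ≈⟨ esymΔ≈esym*Δ^ n n cs χ Δ^[1+n]-indicator≈0 (- c) ⟩
    esym n n cs * Δ^ n χ (- c)             ≈⟨ *-congˡ (esym n n cs) (Δ^n-indicator≈1 (- c)) ⟩
    esym n n cs * + 1                      ≡⟨ *-identityʳ (esym n n cs) ⟩
    esym n n cs                            ≡⟨ esym-top n cs ⟩
    prodℤ n cs                             ∎
    where
    open ≈-Reasoning
    χ = indicator (p ^ h)

  esymΔ≈sign*esymShift : ∀ N → N ≡ n ℕ.+ n → ∀ cs g y → esymΔ N n cs g y ≈ sign n * esymShift N n cs g y
  esymΔ≈sign*esymShift N N≡n+n cs g y = begin
    esymΔ N n cs g y                                             ≡⟨ esymΔ-expansion N n cs g y ⟩
    sumUpTo n term                                               ≈⟨ sumUpTo-≈last n term lower≈0 ⟩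
    sign n * + ((N ∸ n) C (n ∸ n)) * esymShift N n cs g y         ≡⟨ cong (λ k → sign n * + ((N ∸ n) C k) * esymShift N n cs g y) (ℕ.n∸n≡0 n) ⟩
    sign n * + 1 * esymShift N n cs g y                          ≡⟨ cong (_* esymShift N n cs g y) (*-identityʳ (sign n)) ⟩
    sign n * esymShift N n cs g y                                ∎
    where
    open ≈-Reasoning
    term : ℕ → ℤ
    term j = sign j * + ((N ∸ j) C (n ∸ j)) * esymShift N j cs g y
    lower≈0 : ∀ j → j ℕ.< n → term j ≈ + 0
    lower≈0 j j<n = ≈-trans (*-cong (*-congˡ (sign j) (p∣⇒≈0 p∣binomial)) (≈-refl {esymShift N j cs g y}))
                            (≡⇒≈ (trans (cong (_* esymShift N j cs g y) (*-zeroʳ (sign j))) (*-zeroˡ (esymShift N j cs g y))))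
      where
      i = n ∸ suc j
      n∸j≡1+i : n ∸ j ≡ suc i
      n∸j≡1+i = ℕ.+-∸-assoc 1 j<n
      N∸j≡1+n+i : N ∸ j ≡ suc n ℕ.+ i
      N∸j≡1+n+i = trans (cong (_∸ j) N≡n+n) (n+n∸j≡1+n+[n∸1+j] j<n)
      p∣binomial : p ℕ.∣ (N ∸ j) C (n ∸ j)
      p∣binomial = subst₂ (λ u v → p ℕ.∣ u C v) (sym N∸j≡1+n+i) (sym n∸j≡1+i)
        (p∣[m+i]C[1+i] p-prime h (suc n) i (ℕ.∣-reflexive p^h≡1+n)
          (p^h∤j (s≤s z≤n) (s≤s (subst (ℕ._≤ n) n∸j≡1+i (ℕ.m∸n≤m n j)))))

  countSubsets≈coeff : ∀ N → N ≡ n ℕ.+ n → ∀ c cs → + countSubsets (p ^ h) N n c cs ≈ coeff n (linProd N cs)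
  countSubsets≈coeff N N≡n+n c cs = begin
    + countSubsets (p ^ h) N n c cs            ≡⟨ countShifted≡esymShift (p ^ h) N n cs (- c) ⟩
    S                                          ≡⟨ trans (cong (_* S) (sign*sign≡1 n)) (*-identityˡ S) ⟨
    sign n * sign n * S                        ≡⟨ *-assoc (sign n) (sign n) S ⟩
    sign n * (sign n * S)                      ≈⟨ *-congˡ (sign n) (esymΔ≈sign*esymShift N N≡n+n cs χ (- c)) ⟨
    sign n * esymΔ N n cs χ (- c)              ≈⟨ *-congˡ (sign n) (esymΔ≈esym*Δ^ N n cs χ Δ^[1+n]-indicator≈0 (- c)) ⟩
    sign n * (esym N n cs * Δ^ n χ (- c))      ≈⟨ *-congˡ (sign n) (*-congˡ (esym N n cs) (Δ^n-indicator≈1 (- c))) ⟩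
    sign n * (esym N n cs * + 1)               ≡⟨ cong (sign n *_) (*-identityʳ (esym N n cs)) ⟩
    sign n * esym N n cs                       ≡⟨ coeff-linProd N cs n n (sym N≡n+n) ⟨
    coeff n (linProd N cs)                     ∎
    where
    open ≈-Reasoning
    χ = indicator (p ^ h)
    S = esymShift N n cs χ (- c)

corollary3p3 : (p h : ℕ) → Prime p → 1 ℕ.≤ h →
    ((c : ℤ) → (cs : Fin (p ^ h ∸ 1) → ℤ) →
      (+ p) ℤ.∣ (signedSum (p ^ h) (p ^ h ∸ 1) c cs - prodℤ (p ^ h ∸ 1) cs))
    ×
    ((c : ℤ) → (cs : Fin (2 ℕ.* p ^ h ∸ 2) → ℤ) →
      (+ p) ℤ.∣ (+ countSubsets (p ^ h) (2 ℕ.* p ^ h ∸ 2) (p ^ h ∸ 1) c cs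
               - coeff (p ^ h ∸ 1) (linProd (2 ℕ.* p ^ h ∸ 2) cs)))
corollary3p3 p h p-prime _ =
  (λ c cs → ∣⇒∣ᵤ (≈⇒∣ (signedSum≈prodℤ c cs))) ,
  (λ c cs → ∣⇒∣ᵤ (≈⇒∣ (countSubsets≈coeff (2 ℕ.* p ^ h ∸ 2) 2p^h∸2≡n+n c cs)))
  where
  n = p ^ h ∸ 1
  p^h≡1+n : p ^ h ≡ suc n
  p^h≡1+n = sym (ℕ.m+[n∸m]≡n (ℕ.m^n>0 p {{prime⇒nonZero p-prime}} h))
  open PrimePower p-prime h n p^h≡1+n
  open Congruence (+ p)
  2p^h∸2≡n+n : 2 ℕ.* p ^ h ∸ 2 ≡ n ℕ.+ n
  2p^h∸2≡n+n = trans (cong (λ k → 2 ℕ.* k ∸ 2) p^h≡1+n) (cong (_∸ 2) (double-suc n))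
    where
    double-suc : ∀ n → 2 ℕ.* suc n ≡ 2 ℕ.+ (n ℕ.+ n)
    double-suc = ℕ-solve-∀
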